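{- Let $i,j\ge0$ with $(i,j)\neq(0,0)$. The generating function $\mathcal O_{i,j}(t;u,1,1)$ counting osculating $(i,j)$-stars by length (variable $t$) and number of osculations (variable $u$) is algebraic and belongs to $\mathbb{Q}(t,u,\sqrt{1-8t})$. More precisely, letting $T\equiv T(t)$ be the unique formal power series in $t$ with $T=2t(1+T)^2$, $$(1-8t)\,\mathcal O_{i,j}(t;u,1,1)=1-\frac{4-u}{(1+T)^2-uT^2}\left(T^{j+1}-\frac{T^{i+j+1}\,(2(1+T)-u)}{2(1+T)-uT}+T^{i+1}\right).$$
   Context: Consider three directed walkers on the square lattice. At time $0$ they are at abscissa $0$ and ordinates $j_{0,1}\le j_{0,2}\le j_{0,3}$; at each time $m=1,\dots,n$ each walker takes a step $(1,1)$ or $(1,-1)$. Let $j_{m,k}$ be the ordinate of walker $k$ at time $m$; this gives a configuration of length $n$. It is non-crossing if $j_{m,1}\le j_{m,2}\le j_{m,3}$ for all $m\in\{0,\dots,n\}$, and osculating if it is non-crossing and whenever $j_{m,k}=j_{m,k+1}$ with $m\in\{0,\dots,n-1\}$, $k\in\{1,2\}$, then $j_{m+1,k}<j_{m+1,k+1}$. Each pair $(m,k)$ with $m<n$ and $j_{m,k}=j_{m,k+1}$ in an osculating configuration is an osculation (a contact at the final time $n$ is not counted). An $(i,j)$-star is a non-crossing configuration whose walkers start at ordinates $0,2i,2(i+j)$. $\mathcal O_{i,j}(t;u,x,y)=\sum t^{n}u^{s}x^{k}y^{\ell}$, summed over osculating $(i,j)$-stars, where $n$ is the length, $s$ the number of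 osculations, and the final ordinates satisfy $j_{n,2}-j_{n,1}=2k$, $j_{n,3}-j_{n,2}=2\ell$. -}

module Defs where

open import Data.Bool using (Bool; true; false; _∧_; _∨_; not; if_then_else_)
open import Data.Nat as ℕ using (ℕ; zero; suc; _∸_; _≡ᵇ_)
open import Data.Integer as ℤ using (ℤ; +_; _≤ᵇ_)
open import Data.Product using (_×_; _,_; Σ)
open import Data.List using (List; []; _∷_; length; filter; map; concatMap)
open import Relation.Nullary.Decidable using (does)
open import Relation.Binary.PropositionalEquality using (_≡_)
open import Data.Bool.Properties using (T?)

-- A step of one walker: true = (1,1), false = (1,-1).
-- A step of the three walkers at one time.
Step3 : Set
Step3 = Bool × Bool × Bool

-- ordinates (j_{m,1}, j_{m,2}, j_{m,3}) at a given time
Pos : Set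
Pos = ℤ × ℤ × ℤ

δ : Bool → ℤ
δ true  = + 1
δ false = ℤ.- (+ 1)

move : Pos → Step3 → Pos
move (a , b , c) (s₁ , s₂ , s₃) = (a ℤ.+ δ s₁ , b ℤ.+ δ s₂ , c ℤ.+ δ s₃)

_=ᵇ_ : ℤ → ℤ → Bool
x =ᵇ y = (x ≤ᵇ y) ∧ (y ≤ᵇ x)

_<ᵇ_ : ℤ → ℤ → Bool
x <ᵇ y = not (y ≤ᵇ x)

_⇒ᵇ_ : Bool → Bool → Bool
p ⇒ᵇ q = not p ∨ q

ordered : Pos → Bool
ordered (a , b , c) = (a ≤ᵇ b) ∧ (b ≤ᵇ c)

oscRule : Pos → Pos → Bool
oscRule (a , b , c) (a' , b' , c') =
  ((a =ᵇ b) ⇒ᵇ (a' <ᵇ b')) ∧ ((b =ᵇ c) ⇒ᵇ (b' <ᵇ c'))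

contacts : Pos → ℕ
contacts (a , b , c) = (if a =ᵇ b then 1 else 0) ℕ.+ (if b =ᵇ c then 1 else 0)

isOsculating : Pos → List Step3 → Bool
isOsculating p []       = ordered p
isOsculating p (s ∷ ss) = ordered p ∧ oscRule p (move p s) ∧ isOsculating (move p s) ss

-- number of osculations: contacts at times m = 0..n-1 (final time not counted)
osculations : Pos → List Step3 → ℕ
osculations p []       = 0
osculations p (s ∷ ss) = contacts p ℕ.+ osculations (move p s) ss

allStep3 : List Step3
allStep3 = concatMap (λ x → concatMap (λ y → map (λ z → (x , y , z)) (true ∷ false ∷ [])) (true ∷ false ∷ [])) (true ∷ false ∷ [])

-- all step sequences of length n (= all configurations of length n from a fixed start)
configs : ℕ → List (List Step3)
configs zero    = [] ∷ []
configs (suc n) = concatMap (λ s → map (s ∷_) (configs n)) allStep3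

starStart : ℕ → ℕ → Pos
starStart i j = (+ 0 , + (2 ℕ.* i) , + (2 ℕ.* (i ℕ.+ j)))

-- number of osculating (i,j)-stars of length n with exactly s osculations
-- (= coefficient of t^n u^s in O_{i,j}(t;u,1,1))
oscStarCount : ℕ → ℕ → ℕ → ℕ → ℕ
oscStarCount i j n s =
  length (filter (λ c → T? (isOsculating (starStart i j) c ∧ (osculations (starStart i j) c ≡ᵇ s)))
                 (configs n))

Ser₁ : Set
Ser₁ = ℕ → ℤ

-- bivariate series in t,u : F n s = coefficient of t^n u^s
Ser₂ : Set
Ser₂ = ℕ → ℕ → ℤ

sumTo : ℕ → (ℕ → ℤ) → ℤ
sumTo zero    f = f 0
sumTo (suc n) f = sumTo n f ℤ.+ f (suc n)

_+₁_ : Ser₁ → Ser₁ → Ser₁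
(f +₁ g) n = f n ℤ.+ g n

_*₁_ : Ser₁ → Ser₁ → Ser₁
(f *₁ g) n = sumTo n (λ k → f k ℤ.* g (n ∸ k))

const₁ : ℤ → Ser₁
const₁ c zero    = c
const₁ c (suc _) = + 0

t₁ : Ser₁
t₁ 1 = + 1
t₁ _ = + 0

IsT : Ser₁ → Set
IsT T = ∀ n → T n ≡ ((const₁ (+ 2) *₁ t₁) *₁ ((const₁ (+ 1) +₁ T) *₁ (const₁ (+ 1) +₁ T))) n

_+₂_ : Ser₂ → Ser₂ → Ser₂
(f +₂ g) n s = f n s ℤ.+ g n s

_-₂_ : Ser₂ → Ser₂ → Ser₂
(f -₂ g) n s = f n s ℤ.- g n s

_*₂_ : Ser₂ → Ser₂ → Ser₂
(f *₂ g) n s = sumTo n (λ a → sumTo s (λ b → f a b ℤ.* g (n ∸ a) (s ∸ b)))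

infixl 6 _+₂_ _-₂_
infixl 7 _*₂_

const₂ : ℤ → Ser₂
const₂ c zero zero = c
const₂ c _    _    = + 0

t₂ : Ser₂
t₂ 1 0 = + 1
t₂ _ _ = + 0

u₂ : Ser₂
u₂ 0 1 = + 1
u₂ _ _ = + 0

lift : Ser₁ → Ser₂
lift f n zero    = f n
lift f n (suc _) = + 0

_^₂_ : Ser₂ → ℕ → Ser₂
f ^₂ zero  = const₂ (+ 1)
f ^₂ suc k = f *₂ (f ^₂ k)

infixr 8 _^₂_

_≈₂_ : Ser₂ → Ser₂ → Set
f ≈₂ g = ∀ n s → f n s ≡ g n s

infix 4 _≈₂_

Osc : ℕ → ℕ → Ser₂
Osc i j n s = + oscStarCount i j n s

module Submission where

-- Up to vertical translation an (i,j)-star is determined by its two gaps, and the first step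
-- decomposes the osculating stars by these gaps: away from contacts all eight steps are allowed,
-- while two touching walkers must separate, which costs one osculation. With
-- K = (1-8t) D₁ D₂, the series (1-8t) O_{i,j} D₁ D₂ therefore satisfy the linear system
-- X_{i,j} = K + t (u) Σ X_{neighbours}, and so does the closed form, by polynomial identities
-- modulo T - 2t(1+T)². Every unknown on the right is multiplied by t, so the coefficient of tⁿ
-- is determined by lower ones and the system has at most one solution away from (0,0).

open import Algebra.Bundles using (CommutativeRing)
open import Data.Bool using (Bool; true; false; _∧_; not; T; if_then_else_)
open import Data.Bool.Properties using (T?; T-≡; ∧-zeroʳ)
open import Data.Empty using (⊥-elim)
open import Data.Integer as ℤ using (ℤ; +_)
import Data.Integer.Properties as ℤ
open import Data.Integer.Tactic.RingSolver using (solve-∀)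
open import Data.List using (List; []; _∷_; _++_; map; concatMap; foldr; length; filter)
open import Data.List.Properties using (filter-++; length-++; filter-≐; filter-none; map-cong)
open import Data.List.Relation.Unary.All using (universal)
open import Data.Maybe using (Maybe; just; nothing)
open import Data.Nat as ℕ using (ℕ; zero; suc; _∸_; _≤_; z≤n; s≤s)
open import Data.Nat.ListAction using (sum)
import Data.Nat.Properties as ℕ
open import Data.Product using (Σ; _×_; _,_; uncurry)
open import Data.Sum using (inj₁; inj₂)
open import Function using (_∘_; const)
open import Function.Bundles using (Equivalence)
open import Relation.Binary.PropositionalEquality as ≡ using (_≡_; refl; cong; cong₂)
open import Relation.Nullary using (¬_; yes; no)

open import Defs

-- Power series over a commutative ring

module PowerSeries {c ℓ} (R : CommutativeRing c ℓ) where

  open CommutativeRing R renaming (refl to ≈-refl)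
  open import Relation.Binary.Reasoning.Setoid setoid
  open import Algebra.Properties.CommutativeSemigroup +-commutativeSemigroup using (interchange)

  Seq : Set c
  Seq = ℕ → Carrier

  ∑≤ : ℕ → Seq → Carrier
  ∑≤ zero    f = f 0
  ∑≤ (suc n) f = ∑≤ n f + f (suc n)

  ∑≤-cong : ∀ n {f g : Seq} → (∀ k → k ≤ n → f k ≈ g k) → ∑≤ n f ≈ ∑≤ n g
  ∑≤-cong zero    f≈g = f≈g 0 z≤n
  ∑≤-cong (suc n) f≈g =
    +-cong (∑≤-cong n (λ k k≤n → f≈g k (ℕ.m≤n⇒m≤1+n k≤n))) (f≈g (suc n) ℕ.≤-refl)

  ∑≤-+ : ∀ n (f g : Seq) → ∑≤ n (λ k → f k + g k) ≈ ∑≤ n f + ∑≤ n g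
  ∑≤-+ zero    f g = ≈-refl
  ∑≤-+ (suc n) f g = trans (+-congʳ (∑≤-+ n f g)) (interchange _ _ _ _)

  ∑≤-*ˡ : ∀ n a (f : Seq) → a * ∑≤ n f ≈ ∑≤ n (λ k → a * f k)
  ∑≤-*ˡ zero    a f = ≈-refl
  ∑≤-*ˡ (suc n) a f = trans (distribˡ a _ _) (+-congʳ (∑≤-*ˡ n a f))

  ∑≤-zero : ∀ n (f : Seq) → (∀ k → f k ≈ 0#) → ∑≤ n f ≈ 0#
  ∑≤-zero zero    f f≈0 = f≈0 0
  ∑≤-zero (suc n) f f≈0 = trans (+-cong (∑≤-zero n f f≈0) (f≈0 (suc n))) (+-identityˡ 0#)

  ∑≤-single : ∀ n (f : Seq) → (∀ k → f (suc k) ≈ 0#) → ∑≤ n f ≈ f 0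
  ∑≤-single zero    f f≈0 = ≈-refl
  ∑≤-single (suc n) f f≈0 = trans (+-cong (∑≤-single n f f≈0) (f≈0 n)) (+-identityʳ (f 0))

  ∑≤-peelˡ : ∀ n (f : Seq) → ∑≤ (suc n) f ≈ f 0 + ∑≤ n (λ k → f (suc k))
  ∑≤-peelˡ zero    f = ≈-refl
  ∑≤-peelˡ (suc n) f = trans (+-congʳ (∑≤-peelˡ n f)) (+-assoc _ _ _)

  ∑≤-reverse : ∀ n (f : Seq) → ∑≤ n f ≈ ∑≤ n (λ k → f (n ∸ k))
  ∑≤-reverse zero    f = ≈-refl
  ∑≤-reverse (suc n) f = begin
    ∑≤ (suc n) f                         ≈⟨ ∑≤-peelˡ n f ⟩
    f 0 + ∑≤ n (λ k → f (suc k))         ≈⟨ +-congˡ (∑≤-reverse n (λ k → f (suc k))) ⟩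
    f 0 + ∑≤ n (λ k → f (suc (n ∸ k)))   ≈⟨ +-comm _ _ ⟩
    ∑≤ n (λ k → f (suc (n ∸ k))) + f 0   ≈⟨ +-cong (∑≤-cong n (λ k k≤n → reflexive (cong f (≡.sym (ℕ.+-∸-assoc 1 k≤n)))))
                                                  (reflexive (cong f (≡.sym (ℕ.n∸n≡0 n)))) ⟩
    ∑≤ (suc n) (λ k → f (suc n ∸ k))     ∎

  infixl 6 _⊕_
  infixl 7 _⊛_
  infix  4 _≋_

  _≋_ : Seq → Seq → Set ℓ
  f ≋ g = ∀ n → f n ≈ g n

  _⊕_ : Seq → Seq → Seq
  (f ⊕ g) n = f n + g n

  _⊛_ : Seq → Seq → Seq
  (f ⊛ g) n = ∑≤ n (λ k → f k * g (n ∸ k))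

  𝟙 : Seq
  𝟙 zero    = 1#
  𝟙 (suc _) = 0#

  tail : Seq → Seq
  tail f n = f (suc n)

  ⊛-cong : ∀ {f f′ g g′} → f ≋ f′ → g ≋ g′ → f ⊛ g ≋ f′ ⊛ g′
  ⊛-cong f≋f′ g≋g′ n = ∑≤-cong n (λ k _ → *-cong (f≋f′ k) (g≋g′ (n ∸ k)))

  ⊛-suc : ∀ f g n → (f ⊛ g) (suc n) ≈ f 0 * g (suc n) + (tail f ⊛ g) n
  ⊛-suc f g n = ∑≤-peelˡ n (λ k → f k * g (suc n ∸ k))

  ⊛-comm : ∀ f g → f ⊛ g ≋ g ⊛ f
  ⊛-comm f g n = begin
    ∑≤ n (λ k → f k * g (n ∸ k))               ≈⟨ ∑≤-reverse n _ ⟩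
    ∑≤ n (λ k → f (n ∸ k) * g (n ∸ (n ∸ k)))   ≈⟨ ∑≤-cong n (λ k k≤n →
                                                     trans (*-comm _ _) (*-congʳ (reflexive (cong g (ℕ.m∸[m∸n]≡n k≤n))))) ⟩
    ∑≤ n (λ k → g k * f (n ∸ k))               ∎

  ⊛-distribˡ : ∀ f g h → f ⊛ (g ⊕ h) ≋ f ⊛ g ⊕ f ⊛ h
  ⊛-distribˡ f g h n = trans (∑≤-cong n (λ k _ → distribˡ _ _ _)) (∑≤-+ n _ _)

  ⊛-distribʳ : ∀ f g h → (g ⊕ h) ⊛ f ≋ g ⊛ f ⊕ h ⊛ f
  ⊛-distribʳ f g h n = trans (∑≤-cong n (λ k _ → distribʳ _ _ _)) (∑≤-+ n _ _)

  ⊛-identityˡ : ∀ f → 𝟙 ⊛ f ≋ f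
  ⊛-identityˡ f zero    = *-identityˡ _
  ⊛-identityˡ f (suc n) = begin
    (𝟙 ⊛ f) (suc n)                   ≈⟨ ⊛-suc 𝟙 f n ⟩
    1# * f (suc n) + (tail 𝟙 ⊛ f) n   ≈⟨ +-cong (*-identityˡ _) (∑≤-zero n _ (λ _ → zeroˡ _)) ⟩
    f (suc n) + 0#                    ≈⟨ +-identityʳ _ ⟩
    f (suc n)                         ∎

  ⊛-assoc : ∀ f g h → (f ⊛ g) ⊛ h ≋ f ⊛ (g ⊛ h)
  ⊛-assoc f g h zero    = *-assoc _ _ _
  ⊛-assoc f g h (suc n) = begin
    ((f ⊛ g) ⊛ h) (suc n)
      ≈⟨ ⊛-suc (f ⊛ g) h n ⟩
    (f 0 * g 0) * h (suc n) + (tail (f ⊛ g) ⊛ h) n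
      ≈⟨ +-cong (*-assoc _ _ _) (⊛-cong {g = h} (⊛-suc f g) (λ _ → ≈-refl) n) ⟩
    f 0 * (g 0 * h (suc n)) + ((f 0 *· tail g ⊕ tail f ⊛ g) ⊛ h) n
      ≈⟨ +-congˡ (⊛-distribʳ h _ _ n) ⟩
    f 0 * (g 0 * h (suc n)) + ((f 0 *· tail g ⊛ h) n + ((tail f ⊛ g) ⊛ h) n)
      ≈⟨ +-congˡ (+-cong (scale-⊛ n) (⊛-assoc (tail f) g h n)) ⟩
    f 0 * (g 0 * h (suc n)) + (f 0 * (tail g ⊛ h) n + (tail f ⊛ (g ⊛ h)) n)
      ≈⟨ sym (+-assoc _ _ _) ⟩
    (f 0 * (g 0 * h (suc n)) + f 0 * (tail g ⊛ h) n) + (tail f ⊛ (g ⊛ h)) n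
      ≈⟨ +-congʳ (sym (distribˡ _ _ _)) ⟩
    f 0 * (g 0 * h (suc n) + (tail g ⊛ h) n) + (tail f ⊛ (g ⊛ h)) n
      ≈⟨ +-congʳ (*-congˡ (sym (⊛-suc g h n))) ⟩
    f 0 * (g ⊛ h) (suc n) + (tail f ⊛ (g ⊛ h)) n
      ≈⟨ sym (⊛-suc f (g ⊛ h) n) ⟩
    (f ⊛ (g ⊛ h)) (suc n)
      ∎
    where
    _*·_ : Carrier → Seq → Seq
    (a *· f′) k = a * f′ k
    scale-⊛ : ∀ m → (f 0 *· tail g ⊛ h) m ≈ f 0 * (tail g ⊛ h) m
    scale-⊛ m = trans (∑≤-cong m (λ _ _ → *-assoc _ _ _)) (sym (∑≤-*ˡ m (f 0) _))

  commutativeRing : CommutativeRing c ℓ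
  commutativeRing = record
    { Carrier = Seq ; _≈_ = _≋_ ; _+_ = _⊕_ ; _*_ = _⊛_ ; -_ = λ f n → - f n ; 0# = λ _ → 0# ; 1# = 𝟙
    ; isCommutativeRing = record
      { isRing = record
        { +-isAbelianGroup = record
          { isGroup = record
            { isMonoid = record
              { isSemigroup = record
                { isMagma = record
                  { isEquivalence = record
                    { refl = λ _ → ≈-refl ; sym = λ p n → sym (p n) ; trans = λ p q n → trans (p n) (q n) }
                  ; ∙-cong = λ p q n → +-cong (p n) (q n) }
                ; assoc = λ _ _ _ _ → +-assoc _ _ _ }
              ; identity = (λ _ _ → +-identityˡ _) , (λ _ _ → +-identityʳ _) }
            ; inverse = (λ _ _ → -‿inverseˡ _) , (λ _ _ → -‿inverseʳ _)
            ; ⁻¹-cong = λ p n → -‿cong (p n) }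
          ; comm = λ _ _ _ → +-comm _ _ }
        ; *-cong = ⊛-cong
        ; *-assoc = ⊛-assoc
        ; *-identity = ⊛-identityˡ , (λ f n → trans (⊛-comm f 𝟙 n) (⊛-identityˡ f n))
        ; distrib = ⊛-distribˡ , ⊛-distribʳ }
      ; *-comm = ⊛-comm } }

-- The ring of bivariate series

module Series₁ = PowerSeries ℤ.+-*-commutativeRing
module Series₂ = PowerSeries Series₁.commutativeRing

private
  module S = CommutativeRing Series₂.commutativeRing

sumTo≡∑≤ : ∀ n f → sumTo n f ≡ Series₁.∑≤ n f
sumTo≡∑≤ zero    f = refl
sumTo≡∑≤ (suc n) f = cong (ℤ._+ f (suc n)) (sumTo≡∑≤ n f)

sumTo-cong≤ : ∀ n {f g : ℕ → ℤ} → (∀ k → k ≤ n → f k ≡ g k) → sumTo n f ≡ sumTo n g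
sumTo-cong≤ n f≡g = ≡.trans (sumTo≡∑≤ n _) (≡.trans (Series₁.∑≤-cong n f≡g) (≡.sym (sumTo≡∑≤ n _)))

sumTo-zero : ∀ n (f : ℕ → ℤ) → (∀ k → f k ≡ + 0) → sumTo n f ≡ + 0
sumTo-zero n f f≡0 = ≡.trans (sumTo≡∑≤ n f) (Series₁.∑≤-zero n f f≡0)

sumTo-single : ∀ n (f : ℕ → ℤ) → (∀ k → f (suc k) ≡ + 0) → sumTo n f ≡ f 0
sumTo-single n f f≡0 = ≡.trans (sumTo≡∑≤ n f) (Series₁.∑≤-single n f f≡0)

sumTo-peelˡ : ∀ n (f : ℕ → ℤ) → sumTo (suc n) f ≡ f 0 ℤ.+ sumTo n (λ k → f (suc k))
sumTo-peelˡ n f = ≡.trans (sumTo≡∑≤ (suc n) f)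
  (≡.trans (Series₁.∑≤-peelˡ n f) (cong (λ x → f 0 ℤ.+ x) (≡.sym (sumTo≡∑≤ n (λ k → f (suc k))))))

*₂≈⊛ : ∀ F G → F *₂ G ≈₂ F S.* G
*₂≈⊛ F G n s = ≡.trans (inner n) (≡.sym (∑≤-at n _ s))
  where
  inner : ∀ m → sumTo m (λ a → sumTo s (λ b → F a b ℤ.* G (n ∸ a) (s ∸ b)))
              ≡ sumTo m (λ a → (F a Series₁.⊛ G (n ∸ a)) s)
  inner zero    = sumTo≡∑≤ s _
  inner (suc m) = cong₂ ℤ._+_ (inner m) (sumTo≡∑≤ s _)
  ∑≤-at : ∀ m (h : ℕ → Series₁.Seq) s → Series₂.∑≤ m h s ≡ sumTo m (λ a → h a s)
  ∑≤-at zero    h s = refl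
  ∑≤-at (suc m) h s = cong (ℤ._+ h (suc m) s) (∑≤-at m h s)

const₂-zero : const₂ (+ 0) ≈₂ S.0#
const₂-zero zero    zero    = refl
const₂-zero zero    (suc s) = refl
const₂-zero (suc n) s       = refl

const₂-one : const₂ (+ 1) ≈₂ S.1#
const₂-one zero    zero    = refl
const₂-one zero    (suc s) = refl
const₂-one (suc n) s       = refl

module _ where
  open import Relation.Binary.Reasoning.Setoid S.setoid

  *₂-assoc : ∀ F G H → (F *₂ G) *₂ H ≈₂ F *₂ (G *₂ H)
  *₂-assoc F G H = begin
    (F *₂ G) *₂ H       ≈⟨ *₂≈⊛ (F *₂ G) H ⟩
    (F *₂ G) S.* H      ≈⟨ S.*-cong (*₂≈⊛ F G) (S.refl {H}) ⟩
    (F S.* G) S.* H     ≈⟨ S.*-assoc F G H ⟩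
    F S.* (G S.* H)     ≈⟨ S.*-cong (S.refl {F}) (*₂≈⊛ G H) ⟨
    F S.* (G *₂ H)      ≈⟨ *₂≈⊛ F (G *₂ H) ⟨
    F *₂ (G *₂ H)       ∎

  *₂-comm : ∀ F G → F *₂ G ≈₂ G *₂ F
  *₂-comm F G = S.trans (*₂≈⊛ F G) (S.trans (S.*-comm F G) (S.sym (*₂≈⊛ G F)))

  *₂-identityˡ : ∀ F → const₂ (+ 1) *₂ F ≈₂ F
  *₂-identityˡ F = begin
    const₂ (+ 1) *₂ F   ≈⟨ *₂≈⊛ (const₂ (+ 1)) F ⟩
    const₂ (+ 1) S.* F  ≈⟨ S.*-cong const₂-one (S.refl {F}) ⟩
    S.1# S.* F          ≈⟨ S.*-identityˡ F ⟩
    F                   ∎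

  *₂-distribˡ : ∀ F G H → F *₂ (G +₂ H) ≈₂ F *₂ G +₂ F *₂ H
  *₂-distribˡ F G H = begin
    F *₂ (G +₂ H)          ≈⟨ *₂≈⊛ F (G +₂ H) ⟩
    F S.* (G +₂ H)         ≈⟨ S.distribˡ F G H ⟩
    F S.* G +₂ F S.* H     ≈⟨ S.+-cong (*₂≈⊛ F G) (*₂≈⊛ F H) ⟨
    F *₂ G +₂ F *₂ H       ∎

ser₂-commutativeRing : CommutativeRing _ _
ser₂-commutativeRing = record
  { Carrier = Ser₂ ; _≈_ = _≈₂_ ; _+_ = _+₂_ ; _*_ = _*₂_ ; -_ = S.-_ ; 0# = const₂ (+ 0) ; 1# = const₂ (+ 1)
  ; isCommutativeRing = record
    { isRing = record
      { +-isAbelianGroup = record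
        { isGroup = record
          { isMonoid = record
            { isSemigroup = record
              { isMagma = record { isEquivalence = S.isEquivalence ; ∙-cong = S.+-cong }
              ; assoc = S.+-assoc }
            ; identity = (λ F → S.trans (S.+-cong const₂-zero (S.refl {F})) (S.+-identityˡ F))
                       , (λ F → S.trans (S.+-cong (S.refl {F}) const₂-zero) (S.+-identityʳ F)) }
          ; inverse = (λ F → S.trans (S.-‿inverseˡ F) (S.sym const₂-zero))
                    , (λ F → S.trans (S.-‿inverseʳ F) (S.sym const₂-zero))
          ; ⁻¹-cong = S.-‿cong }
        ; comm = S.+-comm }
      ; *-cong = λ {F} {F′} {G} {G′} F≈F′ G≈G′ →
          S.trans (*₂≈⊛ F G) (S.trans (S.*-cong F≈F′ G≈G′) (S.sym (*₂≈⊛ F′ G′)))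
      ; *-assoc = *₂-assoc
      ; *-identity = *₂-identityˡ , (λ F → S.trans (*₂-comm F (const₂ (+ 1))) (*₂-identityˡ F))
      ; distrib = *₂-distribˡ
                , (λ F G H → S.trans (*₂-comm (G +₂ H) F)
                               (S.trans (*₂-distribˡ F G H) (S.+-cong (*₂-comm F G) (*₂-comm F H)))) }
    ; *-comm = *₂-comm } }

module Ser₂ = CommutativeRing ser₂-commutativeRing

const₂-*₂ : ∀ a F n s → (const₂ a *₂ F) n s ≡ a ℤ.* F n s
const₂-*₂ a F n s = ≡.trans (sumTo-single n _ (λ _ → sumTo-zero s _ (λ _ → refl))) (sumTo-single s _ (λ _ → refl))

module Solver where

  open import Algebra.Solver.Ring.AlmostCommutativeRing
    using (fromCommutativeRing; _-Raw-AlmostCommutative⟶_)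

  const₂-homomorphism : CommutativeRing.rawRing ℤ.+-*-commutativeRing
                          -Raw-AlmostCommutative⟶ fromCommutativeRing ser₂-commutativeRing
  const₂-homomorphism = record
    { ⟦_⟧    = const₂
    ; +-homo = λ a b → λ { zero zero → refl ; zero (suc s) → refl ; (suc n) s → refl }
    ; *-homo = λ a b n s → ≡.sym (≡.trans (const₂-*₂ a (const₂ b) n s) (scale-const₂ a b n s))
    ; -‿homo = λ a → λ { zero zero → refl ; zero (suc s) → refl ; (suc n) s → refl }
    ; 0-homo = λ { zero zero → refl ; zero (suc s) → refl ; (suc n) s → refl }
    ; 1-homo = λ { zero zero → refl ; zero (suc s) → refl ; (suc n) s → refl }
    }
    where
    scale-const₂ : ∀ a b n s → a ℤ.* const₂ b n s ≡ const₂ (a ℤ.* b) n s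
    scale-const₂ a b zero    zero    = refl
    scale-const₂ a b zero    (suc s) = ℤ.*-zeroʳ a
    scale-const₂ a b (suc n) s       = ℤ.*-zeroʳ a

  const₂-≟ : ∀ a b → Maybe (const₂ a ≈₂ const₂ b)
  const₂-≟ a b with a ℤ.≟ b
  ... | yes refl = just (λ _ _ → refl)
  ... | no _     = nothing

  open import Algebra.Solver.Ring (CommutativeRing.rawRing ℤ.+-*-commutativeRing)
    (fromCommutativeRing ser₂-commutativeRing) const₂-homomorphism const₂-≟ public

t₂*-coeff-zero : ∀ F s → (t₂ *₂ F) 0 s ≡ + 0
t₂*-coeff-zero F s = sumTo-zero s _ (λ _ → refl)

t₂*-coeff-suc : ∀ F n s → (t₂ *₂ F) (suc n) s ≡ F n s
t₂*-coeff-suc F n s = ≡.trans (sumTo-peelˡ n _)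
  (≡.trans (cong₂ ℤ._+_ (sumTo-zero s _ (λ _ → refl)) (sumTo-single n _ (λ _ → sumTo-zero s _ (λ _ → refl))))
  (≡.trans (ℤ.+-identityˡ _) (≡.trans (sumTo-single s _ (λ _ → refl)) (ℤ.*-identityˡ _))))

u₂*-coeff-zero : ∀ F n → (u₂ *₂ F) n 0 ≡ + 0
u₂*-coeff-zero F n = sumTo-single n _ (λ _ → refl)

u₂*-coeff-suc : ∀ F n s → (u₂ *₂ F) n (suc s) ≡ F n s
u₂*-coeff-suc F n s = ≡.trans (sumTo-single n _ (λ _ → sumTo-zero (suc s) _ (λ _ → refl)))
  (≡.trans (sumTo-peelˡ s _) (≡.trans (ℤ.+-identityˡ _) (≡.trans (sumTo-single s _ (λ _ → refl)) (ℤ.*-identityˡ _))))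

+t₂*-coeff-cong : ∀ K F G n s → (∀ m → n ≡ suc m → F m s ≡ G m s) →
                  (K +₂ t₂ *₂ F) n s ≡ (K +₂ t₂ *₂ G) n s
+t₂*-coeff-cong K F G zero    s _   =
  cong (λ x → K 0 s ℤ.+ x) (≡.trans (t₂*-coeff-zero F s) (≡.sym (t₂*-coeff-zero G s)))
+t₂*-coeff-cong K F G (suc m) s F≡G =
  cong (λ x → K (suc m) s ℤ.+ x) (≡.trans (t₂*-coeff-suc F m s) (≡.trans (F≡G m refl) (≡.sym (t₂*-coeff-suc G m s))))

u₂*-coeff-cong : ∀ F G n s → (∀ r → s ≡ suc r → F n r ≡ G n r) → (u₂ *₂ F) n s ≡ (u₂ *₂ G) n s
u₂*-coeff-cong F G n zero    _   = ≡.trans (u₂*-coeff-zero F n) (≡.sym (u₂*-coeff-zero G n))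
u₂*-coeff-cong F G n (suc r) F≡G = ≡.trans (u₂*-coeff-suc F n r) (≡.trans (F≡G r refl) (≡.sym (u₂*-coeff-suc G n r)))

≈₂-one+t₂* : ∀ X F → (∀ s → X 0 s ≡ const₂ (+ 1) 0 s) → (∀ n s → X (suc n) s ≡ F n s) →
             X ≈₂ const₂ (+ 1) +₂ t₂ *₂ F
≈₂-one+t₂* X F X₀ X₊ zero    s =
  ≡.trans (X₀ s) (≡.sym (≡.trans (cong (λ x → const₂ (+ 1) 0 s ℤ.+ x) (t₂*-coeff-zero F s)) (ℤ.+-identityʳ _)))
≈₂-one+t₂* X F X₀ X₊ (suc n) s =
  ≡.trans (X₊ n s) (≡.sym (≡.trans (ℤ.+-identityˡ _) (t₂*-coeff-suc F n s)))

∑₂ : List Ser₂ → Ser₂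
∑₂ = foldr _+₂_ (const₂ (+ 0))

∑₂-coeff-cong : ∀ {A : Set} (F G : A → Ser₂) xs n s → (∀ x → F x n s ≡ G x n s) →
                ∑₂ (map F xs) n s ≡ ∑₂ (map G xs) n s
∑₂-coeff-cong F G []       n s F≡G = refl
∑₂-coeff-cong F G (x ∷ xs) n s F≡G = cong₂ ℤ._+_ (F≡G x) (∑₂-coeff-cong F G xs n s F≡G)

∑₂-coeff-sum : ∀ {A : Set} (F : A → Ser₂) (f : A → ℕ) xs n s → (∀ x → F x n s ≡ + f x) →
               ∑₂ (map F xs) n s ≡ + sum (map f xs)
∑₂-coeff-sum F f []       n s F≡f = const₂-zero n s
∑₂-coeff-sum F f (x ∷ xs) n s F≡f = cong₂ ℤ._+_ (F≡f x) (∑₂-coeff-sum F f xs n s F≡f)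

*₂-distribˡ-∑₂ : ∀ {A : Set} C (F : A → Ser₂) xs → C *₂ ∑₂ (map F xs) ≈₂ ∑₂ (map (λ x → C *₂ F x) xs)
*₂-distribˡ-∑₂ C F []       = Ser₂.zeroʳ C
*₂-distribˡ-∑₂ C F (x ∷ xs) =
  Ser₂.trans (Ser₂.distribˡ C (F x) (∑₂ (map F xs))) (Ser₂.+-cong (Ser₂.refl {C *₂ F x}) (*₂-distribˡ-∑₂ C F xs))

^₂-+ : ∀ X m n → X ^₂ (m ℕ.+ n) ≈₂ X ^₂ m *₂ X ^₂ n
^₂-+ X zero    n = Ser₂.sym (Ser₂.*-identityˡ (X ^₂ n))
^₂-+ X (suc m) n = Ser₂.trans (Ser₂.*-cong (Ser₂.refl {X}) (^₂-+ X m n)) (Ser₂.sym (Ser₂.*-assoc X (X ^₂ m) (X ^₂ n)))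

-- The linear system of stars

-- A step changes the half-gap (j_{m,k+1} - j_{m,k}) / 2 by (δ s′ - δ s) / 2. The value
-- gapStep true false 0 is junk: that step would make the two walkers cross.
gapStep : Bool → Bool → ℕ → ℕ
gapStep true  true  g = g
gapStep true  false g = ℕ.pred g
gapStep false true  g = suc g
gapStep false false g = g

starAfter : ℕ → ℕ → Step3 → ℕ × ℕ
starAfter i j (s₁ , s₂ , s₃) = gapStep s₁ s₂ i , gapStep s₂ s₃ j

neighbour : (ℕ → ℕ → Ser₂) → ℕ → ℕ → Step3 → Ser₂
neighbour X a b st = uncurry X (starAfter (suc a) (suc b) st)

bulkSum : (ℕ → ℕ → Ser₂) → ℕ → ℕ → Ser₂
bulkSum X a b = ∑₂ (map (neighbour X a b) allStep3)

touch₁₂Sum : (ℕ → ℕ → Ser₂) → ℕ → Ser₂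
touch₁₂Sum X b = X 1 (suc b) +₂ X 1 b

touch₂₃Sum : (ℕ → ℕ → Ser₂) → ℕ → Ser₂
touch₂₃Sum X a = X a 1 +₂ X (suc a) 1

record StarSystem (K : Ser₂) (X : ℕ → ℕ → Ser₂) : Set where
  field
    bulk    : ∀ a b → X (suc a) (suc b) ≈₂ K +₂ t₂ *₂ bulkSum X a b
    touch₁₂ : ∀ b → X 0 (suc b) ≈₂ K +₂ t₂ *₂ (u₂ *₂ touch₁₂Sum X b)
    touch₂₃ : ∀ a → X (suc a) 0 ≈₂ K +₂ t₂ *₂ (u₂ *₂ touch₂₃Sum X a)

starAfter-bulk-≢00 : ∀ a b st → let (i , j) = starAfter (suc a) (suc b) st in ¬ (i ≡ 0 × j ≡ 0)
starAfter-bulk-≢00 a b (true  , true  , _)     (() , _)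
starAfter-bulk-≢00 a b (true  , false , true)  (_ , ())
starAfter-bulk-≢00 a b (true  , false , false) (_ , ())
starAfter-bulk-≢00 a b (false , true  , _)     (() , _)
starAfter-bulk-≢00 a b (false , false , _)     (() , _)

StarSystem-unique : ∀ {K X Y} → StarSystem K X → StarSystem K Y → ∀ i j → ¬ (i ≡ 0 × j ≡ 0) → X i j ≈₂ Y i j
StarSystem-unique {K} {X} {Y} sysX sysY i j ij≢00 n = agree n i j ij≢00
  where
  module SX = StarSystem sysX
  module SY = StarSystem sysY
  open ≡.≡-Reasoning

  Agree : ℕ → Set
  Agree n = ∀ i j → ¬ (i ≡ 0 × j ≡ 0) → ∀ s → X i j n s ≡ Y i j n s

  agree-from-below : ∀ n → (∀ m → n ≡ suc m → Agree m) → Agree n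
  agree-from-below n below zero zero ij≢00 s = ⊥-elim (ij≢00 (refl , refl))
  agree-from-below n below (suc a) (suc b) _ s = begin
    X (suc a) (suc b) n s
      ≡⟨ SX.bulk a b n s ⟩
    (K +₂ t₂ *₂ bulkSum X a b) n s
      ≡⟨ +t₂*-coeff-cong K (bulkSum X a b) (bulkSum Y a b) n s (λ m n≡1+m →
           ∑₂-coeff-cong (neighbour X a b) (neighbour Y a b) allStep3 m s (λ st →
             below m n≡1+m _ _ (starAfter-bulk-≢00 a b st) s)) ⟩
    (K +₂ t₂ *₂ bulkSum Y a b) n s
      ≡⟨ SY.bulk a b n s ⟨
    Y (suc a) (suc b) n s
      ∎
  agree-from-below n below zero (suc b) _ s = begin
    X 0 (suc b) n s
      ≡⟨ SX.touch₁₂ b n s ⟩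
    (K +₂ t₂ *₂ (u₂ *₂ touch₁₂Sum X b)) n s
      ≡⟨ +t₂*-coeff-cong K (u₂ *₂ touch₁₂Sum X b) (u₂ *₂ touch₁₂Sum Y b) n s (λ m n≡1+m →
           u₂*-coeff-cong (touch₁₂Sum X b) (touch₁₂Sum Y b) m s (λ r _ →
             cong₂ ℤ._+_ (below m n≡1+m 1 (suc b) (λ { (() , _) }) r) (below m n≡1+m 1 b (λ { (() , _) }) r))) ⟩
    (K +₂ t₂ *₂ (u₂ *₂ touch₁₂Sum Y b)) n s
      ≡⟨ SY.touch₁₂ b n s ⟨
    Y 0 (suc b) n s
      ∎
  agree-from-below n below (suc a) zero _ s = begin
    X (suc a) 0 n s
      ≡⟨ SX.touch₂₃ a n s ⟩
    (K +₂ t₂ *₂ (u₂ *₂ touch₂₃Sum X a)) n s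
      ≡⟨ +t₂*-coeff-cong K (u₂ *₂ touch₂₃Sum X a) (u₂ *₂ touch₂₃Sum Y a) n s (λ m n≡1+m →
           u₂*-coeff-cong (touch₂₃Sum X a) (touch₂₃Sum Y a) m s (λ r _ →
             cong₂ ℤ._+_ (below m n≡1+m a 1 (λ { (_ , ()) }) r) (below m n≡1+m (suc a) 1 (λ { (_ , ()) }) r))) ⟩
    (K +₂ t₂ *₂ (u₂ *₂ touch₂₃Sum Y a)) n s
      ≡⟨ SY.touch₂₃ a n s ⟨
    Y (suc a) 0 n s
      ∎

  agree : ∀ n → Agree n
  agree zero    = agree-from-below zero (λ _ ())
  agree (suc n) = agree-from-below (suc n) (λ { m refl → agree n })

StarSystem-scale : ∀ C {K X} → StarSystem K X → StarSystem (C *₂ K) (λ i j → C *₂ X i j)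
StarSystem-scale C {K} {X} sys = record
  { bulk    = λ a b → Ser₂.trans (Ser₂.*-cong (Ser₂.refl {C}) (bulk a b))
                (Ser₂.trans (distrib-t C K t₂ (bulkSum X a b))
                  (Ser₂.+-cong (Ser₂.refl {C *₂ K})
                    (Ser₂.*-cong (Ser₂.refl {t₂}) (*₂-distribˡ-∑₂ C (neighbour X a b) allStep3))))
  ; touch₁₂ = λ b → Ser₂.trans (Ser₂.*-cong (Ser₂.refl {C}) (touch₁₂ b)) (distrib-tu C K t₂ u₂ (X 1 (suc b)) (X 1 b))
  ; touch₂₃ = λ a → Ser₂.trans (Ser₂.*-cong (Ser₂.refl {C}) (touch₂₃ a)) (distrib-tu C K t₂ u₂ (X a 1) (X (suc a) 1))
  }
  where
  open StarSystem sys
  open Solver using (solve; _:+_; _:*_; _:=_)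
  distrib-t : ∀ C K t S → C *₂ (K +₂ t *₂ S) ≈₂ C *₂ K +₂ t *₂ (C *₂ S)
  distrib-t = solve 4 (λ C K t S → C :* (K :+ t :* S) := C :* K :+ t :* (C :* S)) Ser₂.refl
  distrib-tu : ∀ C K t u x y → C *₂ (K +₂ t *₂ (u *₂ (x +₂ y))) ≈₂ C *₂ K +₂ t *₂ (u *₂ (C *₂ x +₂ C *₂ y))
  distrib-tu = solve 6 (λ C K t u x y →
    C :* (K :+ t :* (u :* (x :+ y))) := C :* K :+ t :* (u :* (C :* x :+ C :* y))) Ser₂.refl

-- Counting osculating stars

count : {A : Set} → (A → Bool) → List A → ℕ
count p xs = length (filter (T? ∘ p) xs)

count-++ : ∀ {A : Set} (p : A → Bool) xs ys → count p (xs ++ ys) ≡ count p xs ℕ.+ count p ys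
count-++ p xs ys = ≡.trans (cong length (filter-++ (T? ∘ p) xs ys)) (length-++ (filter (T? ∘ p) xs))

count-map : ∀ {A B : Set} (p : B → Bool) (f : A → B) xs → count p (map f xs) ≡ count (p ∘ f) xs
count-map p f []       = refl
count-map p f (x ∷ xs) with p (f x)
... | true  = cong suc (count-map p f xs)
... | false = count-map p f xs

count-concatMap : ∀ {A B : Set} (p : B → Bool) (f : A → List B) xs →
                  count p (concatMap f xs) ≡ sum (map (count p ∘ f) xs)
count-concatMap p f []       = refl
count-concatMap p f (x ∷ xs) =
  ≡.trans (count-++ p (f x) (concatMap f xs)) (cong (count p (f x) ℕ.+_) (count-concatMap p f xs))

count-cong : ∀ {A : Set} {p q : A → Bool} → (∀ x → p x ≡ q x) → ∀ xs → count p xs ≡ count q xs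
count-cong p≡q xs =
  cong length (filter-≐ _ _ ((λ {x} → ≡.subst T (p≡q x)) , (λ {x} → ≡.subst T (≡.sym (p≡q x)))) xs)

count-none : ∀ {A : Set} (p : A → Bool) → (∀ x → p x ≡ false) → ∀ xs → count p xs ≡ 0
count-none p p≡false xs =
  ≡.trans (count-cong p≡false xs) (cong length (filter-none (T? ∘ const false) (universal (λ _ ()) xs)))

osculating? : Pos → ℕ → List Step3 → Bool
osculating? p s c = isOsculating p c ∧ (osculations p c ℕ.≡ᵇ s)

oscCount : Pos → ℕ → ℕ → ℕ
oscCount p n s = count (osculating? p s) (configs n)

stepCount : Pos → Step3 → ℕ → ℕ → ℕ
stepCount p st n s = count (osculating? p s ∘ (st ∷_)) (configs n)

oscCount-suc : ∀ p n s → oscCount p (suc n) s ≡ sum (map (λ st → stepCount p st n s) allStep3)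
oscCount-suc p n s = ≡.trans (count-concatMap _ (λ st → map (st ∷_) (configs n)) allStep3)
  (cong sum (map-cong (λ st → count-map (osculating? p s) (st ∷_) (configs n)) allStep3))

stepCount-blocked : ∀ p st n s → ordered p ∧ oscRule p (move p st) ≡ false → stepCount p st n s ≡ 0
stepCount-blocked p st n s blocked =
  count-none (osculating? p s ∘ (st ∷_)) (λ c → blocked-∧ (ordered p) (oscRule p (move p st)) _ _ blocked) (configs n)
  where
  blocked-∧ : ∀ x y z w → x ∧ y ≡ false → (x ∧ y ∧ z) ∧ w ≡ false
  blocked-∧ true  false _ _ _ = refl
  blocked-∧ false _     _ _ _ = refl

stepCount-allowed : ∀ p st n s → ordered p ≡ true → oscRule p (move p st) ≡ true →
  stepCount p st n s ≡ count (λ c → isOsculating (move p st) c ∧ (contacts p ℕ.+ osculations (move p st) c ℕ.≡ᵇ s))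
                             (configs n)
stepCount-allowed p st n s ord rule rewrite ord | rule = refl

stepCount-free : ∀ p st n s → ordered p ≡ true → oscRule p (move p st) ≡ true → contacts p ≡ 0 →
                 stepCount p st n s ≡ oscCount (move p st) n s
stepCount-free p st n s ord rule free rewrite stepCount-allowed p st n s ord rule | free = refl

stepCount-contact : ∀ p st n s → ordered p ≡ true → oscRule p (move p st) ≡ true → contacts p ≡ 1 →
                    stepCount p st n (suc s) ≡ oscCount (move p st) n s
stepCount-contact p st n s ord rule contact rewrite stepCount-allowed p st n (suc s) ord rule | contact = refl

stepCount-contact-zero : ∀ p st n → contacts p ≡ 1 → stepCount p st n 0 ≡ 0
stepCount-contact-zero p st n contact = count-none (osculating? p 0 ∘ (st ∷_)) no-osculation (configs n)
  where
  no-osculation : ∀ c → osculating? p 0 (st ∷ c) ≡ false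
  no-osculation c rewrite contact = ∧-zeroʳ _

shift : ℤ → Pos → Pos
shift z (a , b , c) = (z ℤ.+ a , z ℤ.+ b , z ℤ.+ c)

T-injective : ∀ {a b} → (T a → T b) → (T b → T a) → a ≡ b
T-injective {true}  {true}  _   _   = refl
T-injective {true}  {false} a⇒b _   = ⊥-elim (a⇒b _)
T-injective {false} {true}  _   b⇒a = ⊥-elim (b⇒a _)
T-injective {false} {false} _   _   = refl

≤ᵇ-shift : ∀ z x y → (z ℤ.+ x ℤ.≤ᵇ z ℤ.+ y) ≡ (x ℤ.≤ᵇ y)
≤ᵇ-shift z x y = T-injective
  (λ z+x≤z+y → ℤ.≤⇒≤ᵇ (≡.subst₂ ℤ._≤_ (cancel x) (cancel y) (ℤ.+-monoʳ-≤ (ℤ.- z) (ℤ.≤ᵇ⇒≤ z+x≤z+y))))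
  (λ x≤y → ℤ.≤⇒≤ᵇ (ℤ.+-monoʳ-≤ z (ℤ.≤ᵇ⇒≤ x≤y)))
  where
  cancel : ∀ w → ℤ.- z ℤ.+ (z ℤ.+ w) ≡ w
  cancel w = ≡.trans (≡.sym (ℤ.+-assoc (ℤ.- z) z w)) (≡.trans (cong (ℤ._+ w) (ℤ.+-inverseˡ z)) (ℤ.+-identityˡ w))

=ᵇ-shift : ∀ z x y → ((z ℤ.+ x) =ᵇ (z ℤ.+ y)) ≡ (x =ᵇ y)
=ᵇ-shift z x y = cong₂ _∧_ (≤ᵇ-shift z x y) (≤ᵇ-shift z y x)

<ᵇ-shift : ∀ z x y → ((z ℤ.+ x) <ᵇ (z ℤ.+ y)) ≡ (x <ᵇ y)
<ᵇ-shift z x y = cong not (≤ᵇ-shift z y x)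

move-shift : ∀ z p st → move (shift z p) st ≡ shift z (move p st)
move-shift z (a , b , c) (s₁ , s₂ , s₃) =
  cong₂ _,_ (ℤ.+-assoc z a _) (cong₂ _,_ (ℤ.+-assoc z b _) (ℤ.+-assoc z c _))

ordered-shift : ∀ z p → ordered (shift z p) ≡ ordered p
ordered-shift z (a , b , c) = cong₂ _∧_ (≤ᵇ-shift z a b) (≤ᵇ-shift z b c)

oscRule-shift : ∀ z p q → oscRule (shift z p) (shift z q) ≡ oscRule p q
oscRule-shift z (a , b , c) (a′ , b′ , c′) =
  cong₂ _∧_ (cong₂ _⇒ᵇ_ (=ᵇ-shift z a b) (<ᵇ-shift z a′ b′)) (cong₂ _⇒ᵇ_ (=ᵇ-shift z b c) (<ᵇ-shift z b′ c′))

contacts-shift : ∀ z p → contacts (shift z p) ≡ contacts p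
contacts-shift z (a , b , c) rewrite =ᵇ-shift z a b | =ᵇ-shift z b c = refl

isOsculating-shift : ∀ z p c → isOsculating (shift z p) c ≡ isOsculating p c
isOsculating-shift z p []       = ordered-shift z p
isOsculating-shift z p (st ∷ c) = cong₂ _∧_ (ordered-shift z p) (cong₂ _∧_
  (≡.trans (cong (oscRule (shift z p)) (move-shift z p st)) (oscRule-shift z p (move p st)))
  (≡.trans (cong (λ q → isOsculating q c) (move-shift z p st)) (isOsculating-shift z (move p st) c)))

osculations-shift : ∀ z p c → osculations (shift z p) c ≡ osculations p c
osculations-shift z p []       = refl
osculations-shift z p (st ∷ c) = cong₂ ℕ._+_ (contacts-shift z p)
  (≡.trans (cong (λ q → osculations q c) (move-shift z p st)) (osculations-shift z (move p st) c))

oscCount-shift : ∀ z p n s → oscCount (shift z p) n s ≡ oscCount p n s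
oscCount-shift z p n s = count-cong
  (λ c → cong₂ (λ b k → b ∧ (k ℕ.≡ᵇ s)) (isOsculating-shift z p c) (osculations-shift z p c)) (configs n)

gapStep-δ : ∀ s s′ g → ¬ (g ≡ 0 × s ≡ true × s′ ≡ false) →
            δ s ℤ.+ + (2 ℕ.* gapStep s s′ g) ≡ + (2 ℕ.* g) ℤ.+ δ s′
gapStep-δ true  true  g       _     = ℤ.+-comm (+ 1) (+ (2 ℕ.* g))
gapStep-δ false false g       _     = ℤ.+-comm (ℤ.- + 1) (+ (2 ℕ.* g))
gapStep-δ false true  g       _     =
  ≡.trans (cong (λ x → ℤ.- + 1 ℤ.+ x) (ℤ.pos-* 2 (suc g)))
  (≡.trans (widen (+ g)) (cong (λ x → x ℤ.+ + 1) (≡.sym (ℤ.pos-* 2 g))))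
  where
  widen : ∀ x → ℤ.- + 1 ℤ.+ + 2 ℤ.* (+ 1 ℤ.+ x) ≡ + 2 ℤ.* x ℤ.+ + 1
  widen = solve-∀
gapStep-δ true  false zero    cross = ⊥-elim (cross (refl , refl , refl))
gapStep-δ true  false (suc g) _     =
  ≡.trans (cong (λ x → + 1 ℤ.+ x) (ℤ.pos-* 2 g))
  (≡.trans (narrow (+ g)) (cong (λ x → x ℤ.+ ℤ.- + 1) (≡.sym (ℤ.pos-* 2 (suc g)))))
  where
  narrow : ∀ x → + 1 ℤ.+ + 2 ℤ.* x ≡ + 2 ℤ.* (+ 1 ℤ.+ x) ℤ.+ ℤ.- + 1
  narrow = solve-∀

move-starStart : ∀ i j s₁ s₂ s₃ → ¬ (i ≡ 0 × s₁ ≡ true × s₂ ≡ false) → ¬ (j ≡ 0 × s₂ ≡ true × s₃ ≡ false) →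
                 move (starStart i j) (s₁ , s₂ , s₃) ≡ shift (δ s₁) (uncurry starStart (starAfter i j (s₁ , s₂ , s₃)))
move-starStart i j s₁ s₂ s₃ i-open j-open =
  cong₂ _,_ (ℤ.+-comm (+ 0) (δ s₁)) (cong₂ _,_ (≡.sym (gapStep-δ s₁ s₂ i i-open)) outer)
  where
  open ≡.≡-Reasoning
  i′ j′ : ℕ
  i′ = gapStep s₁ s₂ i
  j′ = gapStep s₂ s₃ j
  double-+ : ∀ m n → + (2 ℕ.* (m ℕ.+ n)) ≡ + (2 ℕ.* m) ℤ.+ + (2 ℕ.* n)
  double-+ m n = cong +_ (ℕ.*-distribˡ-+ 2 m n)
  outer : + (2 ℕ.* (i ℕ.+ j)) ℤ.+ δ s₃ ≡ δ s₁ ℤ.+ + (2 ℕ.* (i′ ℕ.+ j′))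
  outer = begin
    + (2 ℕ.* (i ℕ.+ j)) ℤ.+ δ s₃              ≡⟨ cong (λ x → x ℤ.+ δ s₃) (double-+ i j) ⟩
    (+ (2 ℕ.* i) ℤ.+ + (2 ℕ.* j)) ℤ.+ δ s₃     ≡⟨ ℤ.+-assoc (+ (2 ℕ.* i)) (+ (2 ℕ.* j)) (δ s₃) ⟩
    + (2 ℕ.* i) ℤ.+ (+ (2 ℕ.* j) ℤ.+ δ s₃)     ≡⟨ cong (λ x → + (2 ℕ.* i) ℤ.+ x) (gapStep-δ s₂ s₃ j j-open) ⟨
    + (2 ℕ.* i) ℤ.+ (δ s₂ ℤ.+ + (2 ℕ.* j′))    ≡⟨ ℤ.+-assoc (+ (2 ℕ.* i)) (δ s₂) (+ (2 ℕ.* j′)) ⟨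
    (+ (2 ℕ.* i) ℤ.+ δ s₂) ℤ.+ + (2 ℕ.* j′)    ≡⟨ cong (λ x → x ℤ.+ + (2 ℕ.* j′)) (gapStep-δ s₁ s₂ i i-open) ⟨
    (δ s₁ ℤ.+ + (2 ℕ.* i′)) ℤ.+ + (2 ℕ.* j′)   ≡⟨ ℤ.+-assoc (δ s₁) (+ (2 ℕ.* i′)) (+ (2 ℕ.* j′)) ⟩
    δ s₁ ℤ.+ (+ (2 ℕ.* i′) ℤ.+ + (2 ℕ.* j′))   ≡⟨ cong (λ x → δ s₁ ℤ.+ x) (double-+ i′ j′) ⟨
    δ s₁ ℤ.+ + (2 ℕ.* (i′ ℕ.+ j′))              ∎

oscCount-move-starStart : ∀ i j s₁ s₂ s₃ →
  ¬ (i ≡ 0 × s₁ ≡ true × s₂ ≡ false) → ¬ (j ≡ 0 × s₂ ≡ true × s₃ ≡ false) → ∀ n s →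
  oscCount (move (starStart i j) (s₁ , s₂ , s₃)) n s ≡ oscCount (uncurry starStart (starAfter i j (s₁ , s₂ , s₃))) n s
oscCount-move-starStart i j s₁ s₂ s₃ i-open j-open n s =
  ≡.trans (cong (λ p → oscCount p n s) (move-starStart i j s₁ s₂ s₃ i-open j-open)) (oscCount-shift (δ s₁) _ n s)

≤ᵇ-true : ∀ {m n} → m ℕ.≤ n → (m ℕ.≤ᵇ n) ≡ true
≤ᵇ-true m≤n = Equivalence.to T-≡ (ℕ.≤⇒≤ᵇ m≤n)

≤ᵇ-false : ∀ {m n} → n ℕ.< m → (m ℕ.≤ᵇ n) ≡ false
≤ᵇ-false {m} {n} n<m with m ℕ.≤ᵇ n in m≤ᵇn
... | false = refl
... | true  = ⊥-elim (ℕ.<⇒≱ n<m (ℕ.≤ᵇ⇒≤ m n (≡.subst T (≡.sym m≤ᵇn) _)))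

ordered-starStart : ∀ i j → ordered (starStart i j) ≡ true
ordered-starStart i j = ≤ᵇ-true (ℕ.*-monoʳ-≤ 2 (ℕ.m≤m+n i j))

contact₂₃-starStart : ∀ i j → ((+ (2 ℕ.* i)) =ᵇ (+ (2 ℕ.* (i ℕ.+ j)))) ≡ (j ℕ.≡ᵇ 0)
contact₂₃-starStart i zero    = cong₂ _∧_ (≤ᵇ-true (ℕ.≤-reflexive same)) (≤ᵇ-true (ℕ.≤-reflexive (≡.sym same)))
  where
  same : 2 ℕ.* i ≡ 2 ℕ.* (i ℕ.+ 0)
  same = cong (2 ℕ.*_) (≡.sym (ℕ.+-identityʳ i))
contact₂₃-starStart i (suc b) = cong₂ _∧_ (≤ᵇ-true (ℕ.<⇒≤ apart)) (≤ᵇ-false apart)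
  where
  apart : 2 ℕ.* i ℕ.< 2 ℕ.* (i ℕ.+ suc b)
  apart = ℕ.*-monoʳ-< 2 (ℕ.m<m+n i (s≤s z≤n))

contacts-apart : ∀ x y z → (x =ᵇ y) ≡ false → (y =ᵇ z) ≡ false → contacts (x , y , z) ≡ 0
contacts-apart x y z x≠y y≠z rewrite x≠y | y≠z = refl

oscRule-apart : ∀ x y z q → (x =ᵇ y) ≡ false → (y =ᵇ z) ≡ false → oscRule (x , y , z) q ≡ true
oscRule-apart x y z q x≠y y≠z rewrite x≠y | y≠z = refl

module Bulk (a b : ℕ) where

  X Y Z : ℤ
  X = + 0
  Y = + (2 ℕ.* suc a)
  Z = + (2 ℕ.* (suc a ℕ.+ suc b))

  apart₂₃ : (Y =ᵇ Z) ≡ false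
  apart₂₃ = contact₂₃-starStart (suc a) (suc b)

  count-suc : ∀ n s → oscCount (starStart (suc a) (suc b)) (suc n) s
                      ≡ sum (map (λ st → oscCount (uncurry starStart (starAfter (suc a) (suc b) st)) n s) allStep3)
  count-suc n s = ≡.trans (oscCount-suc (X , Y , Z) n s) (cong sum (map-cong step allStep3))
    where
    step : ∀ st → stepCount (X , Y , Z) st n s ≡ oscCount (uncurry starStart (starAfter (suc a) (suc b) st)) n s
    step st@(s₁ , s₂ , s₃) = ≡.trans
      (stepCount-free (X , Y , Z) st n s (ordered-starStart (suc a) (suc b))
                      (oscRule-apart X Y Z (move (X , Y , Z) st) refl apart₂₃) (contacts-apart X Y Z refl apart₂₃))
      (oscCount-move-starStart (suc a) (suc b) s₁ s₂ s₃ (λ { (() , _) }) (λ { (() , _) }) n s)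

module Touch₁₂ (b : ℕ) where

  p : Pos
  p = starStart 0 (suc b)

  count-suc : ∀ n s → oscCount p (suc n) (suc s)
                      ≡ oscCount (starStart 1 (suc b)) n s ℕ.+ (oscCount (starStart 1 b) n s ℕ.+ 0)
  count-suc n s = ≡.trans (oscCount-suc p n (suc s)) (cong sum (map-cong step allStep3))
    where
    term : Step3 → ℕ
    term (false , true , s₃) = oscCount (uncurry starStart (starAfter 0 (suc b) (false , true , s₃))) n s
    term _                   = 0
    step : ∀ st → stepCount p st n (suc s) ≡ term st
    step st@(true  , true  , _)  = stepCount-blocked p st n (suc s) refl
    step st@(true  , false , _)  = stepCount-blocked p st n (suc s) refl
    step st@(false , false , _)  = stepCount-blocked p st n (suc s) refl
    step st@(false , true  , s₃) = ≡.trans (stepCount-contact p st n s refl refl refl)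
      (oscCount-move-starStart 0 (suc b) false true s₃ (λ { (_ , () , _) }) (λ { (() , _) }) n s)

  count-zero : ∀ n → oscCount p (suc n) 0 ≡ 0
  count-zero n =
    ≡.trans (oscCount-suc p n 0) (cong sum (map-cong (λ st → stepCount-contact-zero p st n refl) allStep3))

module Touch₂₃ (a : ℕ) where

  p : Pos
  p = starStart (suc a) 0

  contact₂₃ : ((+ (2 ℕ.* suc a)) =ᵇ (+ (2 ℕ.* (suc a ℕ.+ 0)))) ≡ true
  contact₂₃ = contact₂₃-starStart (suc a) 0

  contacts-p : contacts p ≡ 1
  contacts-p = cong (λ c → if c then 1 else 0) contact₂₃

  oscRule-p : ∀ s₁ s₂ s₃ → oscRule p (move p (s₁ , s₂ , s₃)) ≡ (δ s₂ <ᵇ δ s₃)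
  oscRule-p s₁ s₂ s₃ rewrite contact₂₃ =
    ≡.trans (cong (λ k → (+ (2 ℕ.* suc a) ℤ.+ δ s₂) <ᵇ (+ (2 ℕ.* k) ℤ.+ δ s₃)) (ℕ.+-identityʳ (suc a)))
            (<ᵇ-shift (+ (2 ℕ.* suc a)) (δ s₂) (δ s₃))

  count-suc : ∀ n s → oscCount p (suc n) (suc s)
                      ≡ oscCount (starStart a 1) n s ℕ.+ (oscCount (starStart (suc a) 1) n s ℕ.+ 0)
  count-suc n s = ≡.trans (oscCount-suc p n (suc s)) (cong sum (map-cong step allStep3))
    where
    term : Step3 → ℕ
    term (s₁ , false , true) = oscCount (uncurry starStart (starAfter (suc a) 0 (s₁ , false , true))) n s
    term _                   = 0
    blocked : ∀ s₁ s₂ s₃ → (δ s₂ <ᵇ δ s₃) ≡ false → stepCount p (s₁ , s₂ , s₃) n (suc s) ≡ 0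
    blocked s₁ s₂ s₃ rule = stepCount-blocked p (s₁ , s₂ , s₃) n (suc s)
      (≡.trans (cong₂ _∧_ (ordered-starStart (suc a) 0) (oscRule-p s₁ s₂ s₃)) rule)
    step : ∀ st → stepCount p st n (suc s) ≡ term st
    step (s₁ , true  , true)  = blocked s₁ true true refl
    step (s₁ , true  , false) = blocked s₁ true false refl
    step (s₁ , false , false) = blocked s₁ false false refl
    step (s₁ , false , true)  = ≡.trans
      (stepCount-contact p (s₁ , false , true) n s (ordered-starStart (suc a) 0) (oscRule-p s₁ false true) contacts-p)
      (oscCount-move-starStart (suc a) 0 s₁ false true (λ { (() , _) }) (λ { (_ , () , _) }) n s)

  count-zero : ∀ n → oscCount p (suc n) 0 ≡ 0
  count-zero n =
    ≡.trans (oscCount-suc p n 0) (cong sum (map-cong (λ st → stepCount-contact-zero p st n contacts-p) allStep3))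

Osc-length-zero : ∀ i j s → Osc i j 0 s ≡ const₂ (+ 1) 0 s
Osc-length-zero i j zero    rewrite ordered-starStart i j = refl
Osc-length-zero i j (suc s) rewrite ordered-starStart i j = refl

Osc-solves : StarSystem (const₂ (+ 1)) Osc
Osc-solves = record
  { bulk    = λ a b → ≈₂-one+t₂* _ _ (Osc-length-zero (suc a) (suc b)) (λ n s → ≡.trans (cong +_ (Bulk.count-suc a b n s))
                        (≡.sym (∑₂-coeff-sum (neighbour Osc a b) _ allStep3 n s (λ _ → refl))))
  ; touch₁₂ = λ b → ≈₂-one+t₂* _ _ (Osc-length-zero 0 (suc b)) (touch₁₂-coeff b)
  ; touch₂₃ = λ a → ≈₂-one+t₂* _ _ (Osc-length-zero (suc a) 0) (touch₂₃-coeff a)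
  }
  where
  touch₁₂-coeff : ∀ b n s → Osc 0 (suc b) (suc n) s ≡ (u₂ *₂ touch₁₂Sum Osc b) n s
  touch₁₂-coeff b n zero    =
    ≡.trans (cong +_ (Touch₁₂.count-zero b n)) (≡.sym (u₂*-coeff-zero (touch₁₂Sum Osc b) n))
  touch₁₂-coeff b n (suc s) =
    ≡.trans (cong +_ (≡.trans (Touch₁₂.count-suc b n s) (cong (oscCount (starStart 1 (suc b)) n s ℕ.+_) (ℕ.+-identityʳ _))))
            (≡.sym (u₂*-coeff-suc (touch₁₂Sum Osc b) n s))
  touch₂₃-coeff : ∀ a n s → Osc (suc a) 0 (suc n) s ≡ (u₂ *₂ touch₂₃Sum Osc a) n s
  touch₂₃-coeff a n zero    =
    ≡.trans (cong +_ (Touch₂₃.count-zero a n)) (≡.sym (u₂*-coeff-zero (touch₂₃Sum Osc a) n))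
  touch₂₃-coeff a n (suc s) =
    ≡.trans (cong +_ (≡.trans (Touch₂₃.count-suc a n s) (cong (oscCount (starStart a 1) n s ℕ.+_) (ℕ.+-identityʳ _))))
            (≡.sym (u₂*-coeff-suc (touch₂₃Sum Osc a) n s))

-- The series T

2t[1+_]² : Ser₁ → Ser₁
2t[1+ X ]² = (const₁ (+ 2) *₁ t₁) *₁ ((const₁ (+ 1) +₁ X) *₁ (const₁ (+ 1) +₁ X))

*₁-coeff-local : ∀ m {f f′ g g′ : Ser₁} → (∀ k → k ≤ m → f k ≡ f′ k) → (∀ k → k ≤ m → g k ≡ g′ k) →
                 (f *₁ g) m ≡ (f′ *₁ g′) m
*₁-coeff-local m f≡f′ g≡g′ = sumTo-cong≤ m (λ k k≤m → cong₂ ℤ._*_ (f≡f′ k k≤m) (g≡g′ (m ∸ k) (ℕ.m∸n≤m m k)))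

2t[1+_]²-coeff-local : ∀ n {X Y : Ser₁} → (∀ k → k ℕ.< n → X k ≡ Y k) → 2t[1+ X ]² n ≡ 2t[1+ Y ]² n
2t[1+_]²-coeff-local n {X} {Y} X≡Y = sumTo-cong≤ n term
  where
  2t : Ser₁
  2t = const₁ (+ 2) *₁ t₁
  term : ∀ k → k ≤ n → 2t k ℤ.* ((const₁ (+ 1) +₁ X) *₁ (const₁ (+ 1) +₁ X)) (n ∸ k)
                     ≡ 2t k ℤ.* ((const₁ (+ 1) +₁ Y) *₁ (const₁ (+ 1) +₁ Y)) (n ∸ k)
  term zero    _                  = refl
  term (suc k) (s≤s {n = n′} k≤n′) = cong (λ x → 2t (suc k) ℤ.* x) (*₁-coeff-local (n′ ∸ k) below below)
    where
    below : ∀ l → l ≤ n′ ∸ k → (const₁ (+ 1) +₁ X) l ≡ (const₁ (+ 1) +₁ Y) l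
    below l l≤ = cong (λ x → const₁ (+ 1) l ℤ.+ x) (X≡Y l (s≤s (ℕ.≤-trans l≤ (ℕ.m∸n≤m n′ k))))

approxT : ℕ → Ser₁
approxT zero    _ = + 0
approxT (suc m)   = 2t[1+ approxT m ]²

approxT-step : ∀ m k → k ℕ.< m → approxT m k ≡ approxT (suc m) k
approxT-step (suc m) k (s≤s k≤m) = 2t[1+_]²-coeff-local k (λ l l<k → approxT-step m l (ℕ.<-≤-trans l<k k≤m))

approxT-settled : ∀ m k → k ℕ.< m → approxT m k ≡ approxT (suc k) k
approxT-settled (suc m) k (s≤s k≤m) with ℕ.m≤n⇒m<n∨m≡n k≤m
... | inj₁ k<m  = ≡.trans (≡.sym (approxT-step m k k<m)) (approxT-settled m k k<m)
... | inj₂ refl = refl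

T-solution : Ser₁
T-solution n = approxT (suc n) n

T-solution-isT : IsT T-solution
T-solution-isT n = 2t[1+_]²-coeff-local n (λ k k<n → approxT-settled n k k<n)

lift-+₁ : ∀ f g → lift (f +₁ g) ≈₂ lift f +₂ lift g
lift-+₁ f g n zero    = refl
lift-+₁ f g n (suc s) = refl

lift-*₁ : ∀ f g → lift (f *₁ g) ≈₂ lift f *₂ lift g
lift-*₁ f g n zero    = refl
lift-*₁ f g n (suc s) = ≡.sym (sumTo-zero n _ (λ a → sumTo-zero (suc s) _ (λ
  { zero    → ℤ.*-zeroʳ (f a)
  ; (suc b) → ℤ.*-zeroˡ (lift g (n ∸ a) (suc s ∸ suc b)) })))

lift-const₁ : ∀ c → lift (const₁ c) ≈₂ const₂ c
lift-const₁ c zero    zero    = refl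
lift-const₁ c zero    (suc s) = refl
lift-const₁ c (suc n) zero    = refl
lift-const₁ c (suc n) (suc s) = refl

lift-t₁ : lift t₁ ≈₂ t₂
lift-t₁ zero          zero    = refl
lift-t₁ zero          (suc s) = refl
lift-t₁ (suc zero)    zero    = refl
lift-t₁ (suc zero)    (suc s) = refl
lift-t₁ (suc (suc n)) zero    = refl
lift-t₁ (suc (suc n)) (suc s) = refl

lift-2t[1+_]² : ∀ X → lift 2t[1+ X ]² ≈₂ const₂ (+ 2) *₂ t₂ *₂ ((const₂ (+ 1) +₂ lift X) *₂ (const₂ (+ 1) +₂ lift X))
lift-2t[1+_]² X =
  Ser₂.trans (lift-*₁ _ _) (Ser₂.*-cong (Ser₂.trans (lift-*₁ _ _) (Ser₂.*-cong (lift-const₁ (+ 2)) lift-t₁))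
                                       (Ser₂.trans (lift-*₁ _ _) (Ser₂.*-cong one+X one+X)))
  where
  one+X : lift (const₁ (+ 1) +₁ X) ≈₂ const₂ (+ 1) +₂ lift X
  one+X = Ser₂.trans (lift-+₁ _ _) (Ser₂.+-cong (lift-const₁ (+ 1)) (Ser₂.refl {lift X}))

-- The closed form

module ClosedForm (T : Ser₁) where

  open Solver using (solve; Polynomial; _:+_; _:*_; _:-_; _:=_; con)

  𝐓 D₁ D₂ N K relation : Ser₂
  𝐓  = lift T
  D₁ = (const₂ (+ 1) +₂ 𝐓) ^₂ 2 -₂ u₂ *₂ 𝐓 ^₂ 2
  D₂ = const₂ (+ 2) *₂ (const₂ (+ 1) +₂ 𝐓) -₂ u₂ *₂ 𝐓
  N  = const₂ (+ 2) *₂ (const₂ (+ 1) +₂ 𝐓) -₂ u₂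
  K  = (const₂ (+ 1) -₂ const₂ (+ 8) *₂ t₂) *₂ D₁ *₂ D₂
  relation = 𝐓 -₂ const₂ (+ 2) *₂ t₂ *₂ ((const₂ (+ 1) +₂ 𝐓) *₂ (const₂ (+ 1) +₂ 𝐓))

  closedForm : ℕ → ℕ → Ser₂
  closedForm i j =
    D₁ *₂ D₂ -₂ (const₂ (+ 4) -₂ u₂) *₂ (𝐓 *₂ 𝐓 ^₂ j *₂ D₂ -₂ 𝐓 *₂ 𝐓 ^₂ i *₂ 𝐓 ^₂ j *₂ N +₂ 𝐓 *₂ 𝐓 ^₂ i *₂ D₂)

  bulkCofactor : ℕ → ℕ → Ser₂
  bulkCofactor a b = (const₂ (+ 4) -₂ u₂) *₂ 𝐓 *₂ (𝐓 *₂ 𝐓 ^₂ a *₂ 𝐓 ^₂ b *₂ N -₂ (𝐓 ^₂ a +₂ 𝐓 ^₂ b) *₂ D₂)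

  touchCofactor : ℕ → Ser₂
  touchCofactor k =
    (u₂ -₂ const₂ (+ 4)) *₂ (const₂ (+ 2) +₂ (const₂ (+ 2) -₂ u₂) *₂ 𝐓 +₂ u₂ *₂ 𝐓 *₂ (const₂ (+ 1) -₂ 𝐓) *₂ 𝐓 ^₂ k)

  private
    c : ∀ {m} → ℤ → Polynomial m
    c = con

    module _ {m} (t u T : Polynomial m) where

      relationₚ : Polynomial m
      relationₚ = T :- c (+ 2) :* t :* ((c (+ 1) :+ T) :* (c (+ 1) :+ T))

      module _ (d₁ d₂ n : Polynomial m) where
        Kₚ : Polynomial m
        Kₚ = (c (+ 1) :- c (+ 8) :* t) :* d₁ :* d₂ :* c (+ 1)

        closedFormₚ : Polynomial m → Polynomial m → Polynomial m
        closedFormₚ A B = d₁ :* d₂ :- (c (+ 4) :- u) :* (T :* B :* d₂ :- T :* A :* B :* n :+ T :* A :* d₂)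

      D₁ₚ D₂ₚ Nₚ : Polynomial m
      D₁ₚ = (c (+ 1) :+ T) :* ((c (+ 1) :+ T) :* c (+ 1)) :- u :* (T :* (T :* c (+ 1)))
      D₂ₚ = c (+ 2) :* (c (+ 1) :+ T) :- u :* T
      Nₚ  = c (+ 2) :* (c (+ 1) :+ T) :- u

  -- Summed over the eight steps, T^{i′}, T^{j′} and T^{i′+j′} give 2(1+T)²/T times T^i, T^j and
  -- T^{i+j}, i.e. 1/t times them modulo the relation; so t times the neighbour sum is closedForm - K.
  closedForm-bulk : ∀ a b → closedForm (suc a) (suc b)
    ≈₂ K *₂ const₂ (+ 1) +₂ t₂ *₂ bulkSum closedForm a b +₂ relation *₂ bulkCofactor a b
  closedForm-bulk a b = solve 8 (λ t u T A B d₁ d₂ n →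
    let cf = closedFormₚ t u T d₁ d₂ n in
    cf (T :* A) (T :* B)
    := Kₚ t u T d₁ d₂ n
       :+ t :* (cf (T :* A) (T :* B) :+ (cf (T :* A) B :+ (cf A (T :* (T :* B)) :+ (cf A (T :* B)
       :+ (cf (T :* (T :* A)) (T :* B) :+ (cf (T :* (T :* A)) B :+ (cf (T :* A) (T :* (T :* B))
       :+ (cf (T :* A) (T :* B) :+ c (+ 0)))))))))
       :+ relationₚ t u T :* ((c (+ 4) :- u) :* T :* (T :* A :* B :* n :- (A :+ B) :* d₂)))
    Ser₂.refl t₂ u₂ 𝐓 (𝐓 ^₂ a) (𝐓 ^₂ b) D₁ D₂ N

  closedForm-touch₁₂ : ∀ b → closedForm 0 (suc b)
    ≈₂ K *₂ const₂ (+ 1) +₂ t₂ *₂ (u₂ *₂ touch₁₂Sum closedForm b) +₂ relation *₂ touchCofactor b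
  closedForm-touch₁₂ b = solve 4 (λ t u T B →
    let cf = closedFormₚ t u T (D₁ₚ t u T) (D₂ₚ t u T) (Nₚ t u T) in
    cf (c (+ 1)) (T :* B)
    := Kₚ t u T (D₁ₚ t u T) (D₂ₚ t u T) (Nₚ t u T)
       :+ t :* (u :* (cf (T :* c (+ 1)) (T :* B) :+ cf (T :* c (+ 1)) B))
       :+ relationₚ t u T :* ((u :- c (+ 4)) :* (c (+ 2) :+ (c (+ 2) :- u) :* T :+ u :* T :* (c (+ 1) :- T) :* B)))
    Ser₂.refl t₂ u₂ 𝐓 (𝐓 ^₂ b)

  closedForm-touch₂₃ : ∀ a → closedForm (suc a) 0
    ≈₂ K *₂ const₂ (+ 1) +₂ t₂ *₂ (u₂ *₂ touch₂₃Sum closedForm a) +₂ relation *₂ touchCofactor a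
  closedForm-touch₂₃ a = solve 4 (λ t u T A →
    let cf = closedFormₚ t u T (D₁ₚ t u T) (D₂ₚ t u T) (Nₚ t u T) in
    cf (T :* A) (c (+ 1))
    := Kₚ t u T (D₁ₚ t u T) (D₂ₚ t u T) (Nₚ t u T)
       :+ t :* (u :* (cf A (T :* c (+ 1)) :+ cf (T :* A) (T :* c (+ 1))))
       :+ relationₚ t u T :* ((u :- c (+ 4)) :* (c (+ 2) :+ (c (+ 2) :- u) :* T :+ u :* T :* (c (+ 1) :- T) :* A)))
    Ser₂.refl t₂ u₂ 𝐓 (𝐓 ^₂ a)

  K-factor : ∀ X → (const₂ (+ 1) -₂ const₂ (+ 8) *₂ t₂) *₂ X *₂ D₁ *₂ D₂ ≈₂ K *₂ X
  K-factor = solve 4 (λ t d₁ d₂ X →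
    (c (+ 1) :- c (+ 8) :* t) :* X :* d₁ :* d₂ := (c (+ 1) :- c (+ 8) :* t) :* d₁ :* d₂ :* X) Ser₂.refl t₂ D₁ D₂

  closedForm-powers : ∀ i j →
    D₁ *₂ D₂ -₂ (const₂ (+ 4) -₂ u₂) *₂ (𝐓 ^₂ (j ℕ.+ 1) *₂ D₂ -₂ 𝐓 ^₂ (i ℕ.+ j ℕ.+ 1) *₂ N +₂ 𝐓 ^₂ (i ℕ.+ 1) *₂ D₂)
    ≈₂ closedForm i j
  closedForm-powers i j =
    Ser₂.+-cong (Ser₂.refl {D₁ *₂ D₂}) (Ser₂.-‿cong (Ser₂.*-cong (Ser₂.refl {const₂ (+ 4) -₂ u₂})
      (Ser₂.+-cong (Ser₂.+-cong (Ser₂.*-cong (^₂-+1 j) (Ser₂.refl {D₂})) (Ser₂.-‿cong (Ser₂.*-cong ^₂-i+j+1 (Ser₂.refl {N}))))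
                   (Ser₂.*-cong (^₂-+1 i) (Ser₂.refl {D₂})))))
    where
    ^₂-+1 : ∀ k → 𝐓 ^₂ (k ℕ.+ 1) ≈₂ 𝐓 *₂ 𝐓 ^₂ k
    ^₂-+1 k = Ser₂.reflexive (cong (𝐓 ^₂_) (ℕ.+-comm k 1))
    ^₂-i+j+1 : 𝐓 ^₂ (i ℕ.+ j ℕ.+ 1) ≈₂ 𝐓 *₂ 𝐓 ^₂ i *₂ 𝐓 ^₂ j
    ^₂-i+j+1 = Ser₂.trans (^₂-+1 (i ℕ.+ j))
      (Ser₂.trans (Ser₂.*-cong (Ser₂.refl {𝐓}) (^₂-+ 𝐓 i j)) (Ser₂.sym (Ser₂.*-assoc 𝐓 (𝐓 ^₂ i) (𝐓 ^₂ j))))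

  module _ (isT : IsT T) where

    relation≈0 : relation ≈₂ const₂ (+ 0)
    relation≈0 = Ser₂.trans (Ser₂.+-cong T-equation (Ser₂.refl {Ser₂.- R})) (Ser₂.-‿inverseʳ R)
      where
      R : Ser₂
      R = const₂ (+ 2) *₂ t₂ *₂ ((const₂ (+ 1) +₂ 𝐓) *₂ (const₂ (+ 1) +₂ 𝐓))
      T-equation : 𝐓 ≈₂ R
      T-equation = Ser₂.trans (λ { n zero → isT n ; n (suc s) → refl }) (lift-2t[1+_]² T)

    drop-relation : ∀ W q → W +₂ relation *₂ q ≈₂ W
    drop-relation W q =
      Ser₂.trans (Ser₂.+-cong (Ser₂.refl {W}) (Ser₂.trans (Ser₂.*-cong relation≈0 (Ser₂.refl {q})) (Ser₂.zeroˡ q)))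
                 (Ser₂.+-identityʳ W)

    closedForm-solves : StarSystem (K *₂ const₂ (+ 1)) closedForm
    closedForm-solves = record
      { bulk    = λ a b → Ser₂.trans (closedForm-bulk a b)
                    (drop-relation (K *₂ const₂ (+ 1) +₂ t₂ *₂ bulkSum closedForm a b) (bulkCofactor a b))
      ; touch₁₂ = λ b → Ser₂.trans (closedForm-touch₁₂ b)
                    (drop-relation (K *₂ const₂ (+ 1) +₂ t₂ *₂ (u₂ *₂ touch₁₂Sum closedForm b)) (touchCofactor b))
      ; touch₂₃ = λ a → Ser₂.trans (closedForm-touch₂₃ a)
                    (drop-relation (K *₂ const₂ (+ 1) +₂ t₂ *₂ (u₂ *₂ touch₂₃Sum closedForm a)) (touchCofactor a))
      }

open import Data.Nat using (_+_)

proposition3 : (i j : ℕ) → ¬ (i ≡ 0 × j ≡ 0) →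
    Σ Ser₁ IsT ×
    ((T : Ser₁) → IsT T →
      let 𝐓  = lift T
          D₁ = (const₂ (+ 1) +₂ 𝐓) ^₂ 2 -₂ u₂ *₂ 𝐓 ^₂ 2
          D₂ = const₂ (+ 2) *₂ (const₂ (+ 1) +₂ 𝐓) -₂ u₂ *₂ 𝐓
          N  = const₂ (+ 2) *₂ (const₂ (+ 1) +₂ 𝐓) -₂ u₂
      in (const₂ (+ 1) -₂ const₂ (+ 8) *₂ t₂) *₂ Osc i j *₂ D₁ *₂ D₂
         ≈₂ (D₁ *₂ D₂ -₂ (const₂ (+ 4) -₂ u₂)
               *₂ (𝐓 ^₂ (j + 1) *₂ D₂ -₂ 𝐓 ^₂ (i + j + 1) *₂ N +₂ 𝐓 ^₂ (i + 1) *₂ D₂)))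
proposition3 i j ij≢00 = (T-solution , T-solution-isT) , λ T isT → let open ClosedForm T in begin
  (const₂ (+ 1) -₂ const₂ (+ 8) *₂ t₂) *₂ Osc i j *₂ D₁ *₂ D₂
    ≈⟨ K-factor (Osc i j) ⟩
  K *₂ Osc i j
    ≈⟨ StarSystem-unique (StarSystem-scale K Osc-solves) (closedForm-solves isT) i j ij≢00 ⟩
  closedForm i j
    ≈⟨ closedForm-powers i j ⟨
  _ ∎
  where open import Relation.Binary.Reasoning.Setoid Ser₂.setoid
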